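{- Let $l\geq 2$, and let $H$ be a hypergraph with $n$ vertices and $n'<n$ an integer such that: (1) $H$ is $(2l+2)$-modest; (2) the number of red vertices of $H$ is $<n'$; (3) every vertex set of cardinality $\geq n'$ includes a hyperedge; (4) for every nonempty vertex set $X$ of cardinality $<n'$ there exist a vertex $x\in X$ and distinct hyperedges $h_1,h_2$ with $h_1\cap X=h_2\cap X=\{x\}$. Then the green sub-hypergraph of $H$ is an odd, $l$-meager hypergraph with more than $n-n'$ vertices.
   Context: A hypergraph is a pair $H=(U,T)$ with $U$ a finite nonempty vertex set and $T$ a collection of 3-element subsets of $U$ (hyperedges). For nonempty $X\subseteq U$, $\|X\|$ is its cardinality, $[X]$ is the number of hyperedges contained in $X$, and the sub-hypergraph $H|X=(X,\{h\in T: h\subseteq X\})$. $X$ is dense if $\|X\|\le2[X]$, super-dense if $\|X\|<2[X]$; a minimal dense set is a dense set with no proper nonempty dense subset. $H$ is $m$-meager if it has no dense vertex sets of cardinality $\le2m$, and $m$-modest if it has no super-dense vertex sets of cardinality $\le 2m$. $H$ is odd if for every nonempty vertex set $X$ there is a hyperedge $h$ with $\|h\cap X\|$ odd. With respect to $l$: a red block is a minimal dense vertex set of cardinality $\le2l$; a vertex is red if it belongs to a red block and green otherwise; the green sub-hypergraph is $H|G$ where $G$ is the set of green vertices. -}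

module Defs where

open import Data.Nat using (ℕ; _≤_; _<_; _*_; _%_)
open import Data.Fin using (Fin)
open import Data.Fin.Subset using (Subset; _∈_; _⊆_; _⊂_; _∩_; ∣_∣; Nonempty; ⁅_⁆)
open import Data.Fin.Subset.Properties using (_⊆?_)
open import Data.List using (List; length; filter)
open import Data.List.Membership.Propositional using () renaming (_∈_ to _∈ₗ_)
open import Data.List.Relation.Unary.All using (All)
open import Data.List.Relation.Unary.Unique.Propositional using (Unique)
open import Data.Product using (Σ; ∃; ∃-syntax; _×_)
open import Relation.Binary.PropositionalEquality using (_≡_; _≢_)
open import Relation.Nullary using (¬_)

record Hypergraph (n : ℕ) : Set where
  field
    edges  : List (Subset n)
    unique : Unique edges
    size3  : All (λ h → ∣ h ∣ ≡ 3) edges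
open Hypergraph public

module _ {n : ℕ} (H : Hypergraph n) where

  ⟦_⟧ : Subset n → ℕ
  ⟦ X ⟧ = length (filter (_⊆? X) (edges H))

  Dense : Subset n → Set
  Dense X = Nonempty X × ∣ X ∣ ≤ 2 * ⟦ X ⟧

  SuperDense : Subset n → Set
  SuperDense X = Nonempty X × ∣ X ∣ < 2 * ⟦ X ⟧

  MinimalDense : Subset n → Set
  MinimalDense X = Dense X × (∀ Y → Y ⊂ X → ¬ Dense Y)

  Modest : ℕ → Set
  Modest m = ∀ X → ∣ X ∣ ≤ 2 * m → ¬ SuperDense X

  RedBlock : ℕ → Subset n → Set
  RedBlock l B = MinimalDense B × ∣ B ∣ ≤ 2 * l

  Red : ℕ → Fin n → Set
  Red l v = ∃[ B ] (RedBlock l B × v ∈ B)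

  IsRedSet : ℕ → Subset n → Set
  IsRedSet l R = ∀ v → (v ∈ R → Red l v) × (Red l v → v ∈ R)

  -- Properties of the sub-hypergraph H|G (vertex set G, hyperedges of H
  -- contained in G).  For X ⊆ G, the number of hyperedges of H|G inside X
  -- equals ⟦ X ⟧.

  OddOn : Subset n → Set
  OddOn G = ∀ X → X ⊆ G → Nonempty X →
    ∃[ h ] (h ∈ₗ edges H × h ⊆ G × ∣ h ∩ X ∣ % 2 ≡ 1)

  MeagerOn : Subset n → ℕ → Set
  MeagerOn G m = ∀ X → X ⊆ G → ∣ X ∣ ≤ 2 * m → ¬ Dense X

  BigSetsHaveEdges : ℕ → Set
  BigSetsHaveEdges k = ∀ X → k ≤ ∣ X ∣ → ∃[ h ] (h ∈ₗ edges H × h ⊆ X)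

  SmallSetsCondition : ℕ → Set
  SmallSetsCondition k = ∀ X → Nonempty X → ∣ X ∣ < k →
    ∃[ x ] (x ∈ X × ∃[ h₁ ] ∃[ h₂ ] (h₁ ∈ₗ edges H × h₂ ∈ₗ edges H × h₁ ≢ h₂
      × h₁ ∩ X ≡ ⁅ x ⁆ × h₂ ∩ X ≡ ⁅ x ⁆))

-- The edge count [_] is supermodular, so the union of a minimal dense set
-- with any dense set is again dense; hence any two red vertices lie in a
-- common dense set of red vertices of cardinality at most 4l.  If two
-- distinct hyperedges through a green vertex y both met red vertices, adding
-- them to such a set B would add at most 3 vertices but 2 hyperedges, giving
-- a super-dense set of cardinality at most 4l + 3, against (2l+2)-modesty.
-- So of the two hyperedges of condition (4) one is green, and it meets a
-- small green set X in exactly one vertex; a large X contains a hyperedge,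
-- meeting X in 3 vertices.  Meagerness holds because every dense set
-- contains a minimal dense one, whose vertices are red.

module Submission where

open import Defs
open import Data.Nat using (ℕ; suc; _≤_; _<_; _+_; _*_; _∸_; _%_; z≤n; s≤s; _≤?_)
open import Data.Nat.Properties
  using (≤-refl; ≤-pred; ≤-trans; +-assoc; ≤-reflexive; <⇒≤; ≰⇒>; n≢0⇒n>0; m≤m+n; m≤n+m; +-suc;
         +-mono-≤; +-monoˡ-≤; +-monoʳ-≤; +-monoʳ-<; n<1+n; n≤1+n; +-cancelʳ-≤; *-monoʳ-≤; *-distribˡ-+;
         ∸-monoʳ-<; +-commutativeSemigroup; module ≤-Reasoning)
open import Algebra.Properties.CommutativeSemigroup +-commutativeSemigroup using (interchange)
open import Data.Nat.ListAction using (sum)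
open import Data.Nat.Solver using (module +-*-Solver)
open import Data.Fin using (Fin)
open import Data.Fin.Subset
  using (Subset; ∁; ∣_∣; _∈_; _∉_; _⊆_; _⊂_; _∪_; _∩_; ⁅_⁆; Nonempty; inside; outside)
open import Data.Fin.Subset.Properties
  using (_∈?_; _⊆?_; _⊂?_; nonempty?; anySubset?; Empty-unique; ∣⊥∣≡0; ∣⁅x⁆∣≡1;
         x∈⁅x⁆; x∈p∧x≢y⇒x∈p-y; x∈p⇒∣p-x∣<∣p∣; ⊆-trans; p⊆q⇒∣p∣≤∣q∣; ⊆-antisym; p⊆p∪q; q⊆p∪q;
         x∈p∪q⁻; x∈p∩q⁺; x∈p∩q⁻; p∩q⊆p; x∈∁p⇒x∉p; x∉∁p⇒x∈p; p⊂q⇒∣p∣<∣q∣;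
         p⊂q⇒p⊆q; ∣∁p∣≡n∸∣p∣)
open import Data.Fin.Properties using (any?)
open import Data.Bool.Properties using () renaming (_≟_ to _≟ᵇ_)
open import Data.Vec using ([]; _∷_)
open import Data.Vec.Properties using (≡-dec)
open import Data.List using (List; []; _∷_; length; filter; map)
open import Data.List.Membership.Propositional using () renaming (_∈_ to _∈ₗ_)
open import Data.List.Membership.Propositional.Properties using (∈-filter⁻)
open import Data.List.Relation.Unary.Any using (here; there)
import Data.List.Relation.Unary.All as All
open import Data.Product using (_×_; _,_; proj₁; proj₂; ∃-syntax)
open import Data.Sum using (_⊎_; inj₁; inj₂)
open import Data.Empty using (⊥-elim)
open import Function using (_∘_; id)
open import Relation.Nullary using (¬_; Dec; yes; no; contradiction)
open import Relation.Nullary.Decidable using (_×-dec_; ¬?)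
open import Relation.Unary using (Pred; Decidable)
open import Relation.Binary.PropositionalEquality
  using (_≡_; _≢_; refl; sym; trans; cong; cong₂; subst)

indicator : ∀ {p} {P : Set p} → Dec P → ℕ
indicator (yes _) = 1
indicator (no _)  = 0

indicator-yes : ∀ {p} {P : Set p} (P? : Dec P) → P → indicator P? ≡ 1
indicator-yes (yes _)  _  = refl
indicator-yes (no ¬px) px = contradiction px ¬px

module _ {a} {A : Set a} where

  sum-map-+ : (f g : A → ℕ) (xs : List A) →
              sum (map (λ x → f x + g x) xs) ≡ sum (map f xs) + sum (map g xs)
  sum-map-+ f g []       = refl
  sum-map-+ f g (x ∷ xs) =
    trans (cong (f x + g x +_) (sum-map-+ f g xs)) (interchange (f x) (g x) _ _)

  sum-map-mono : {f g : A → ℕ} (xs : List A) → (∀ {x} → x ∈ₗ xs → f x ≤ g x) →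
                 sum (map f xs) ≤ sum (map g xs)
  sum-map-mono []       _   = z≤n
  sum-map-mono (x ∷ xs) f≤g = +-mono-≤ (f≤g (here refl)) (sum-map-mono xs (f≤g ∘ there))

  ∈⇒≤sum-map : (f : A → ℕ) {x : A} {xs : List A} → x ∈ₗ xs → f x ≤ sum (map f xs)
  ∈⇒≤sum-map f (here refl) = m≤m+n _ _
  ∈⇒≤sum-map f (there x∈)  = ≤-trans (∈⇒≤sum-map f x∈) (m≤n+m _ _)

  length-filter≡sum-indicator : ∀ {p} {P : Pred A p} (P? : Decidable P) (xs : List A) →
                                length (filter P? xs) ≡ sum (map (indicator ∘ P?) xs)
  length-filter≡sum-indicator P? []       = refl
  length-filter≡sum-indicator P? (x ∷ xs) with P? x
  ... | yes _ = cong suc (length-filter≡sum-indicator P? xs)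
  ... | no  _ = length-filter≡sum-indicator P? xs

∣p∪q∣+∣p∩q∣≡∣p∣+∣q∣ : ∀ {n} (p q : Subset n) → ∣ p ∪ q ∣ + ∣ p ∩ q ∣ ≡ ∣ p ∣ + ∣ q ∣
∣p∪q∣+∣p∩q∣≡∣p∣+∣q∣ []            []            = refl
∣p∪q∣+∣p∩q∣≡∣p∣+∣q∣ (outside ∷ p) (outside ∷ q) = ∣p∪q∣+∣p∩q∣≡∣p∣+∣q∣ p q
∣p∪q∣+∣p∩q∣≡∣p∣+∣q∣ (outside ∷ p) (inside ∷ q)  =
  trans (cong suc (∣p∪q∣+∣p∩q∣≡∣p∣+∣q∣ p q)) (sym (+-suc _ _))
∣p∪q∣+∣p∩q∣≡∣p∣+∣q∣ (inside ∷ p)  (outside ∷ q) = cong suc (∣p∪q∣+∣p∩q∣≡∣p∣+∣q∣ p q)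
∣p∪q∣+∣p∩q∣≡∣p∣+∣q∣ (inside ∷ p)  (inside ∷ q)  =
  cong suc (trans (+-suc _ _) (trans (cong suc (∣p∪q∣+∣p∩q∣≡∣p∣+∣q∣ p q)) (sym (+-suc _ _))))

module _ {n : ℕ} where

  ∣p∪q∣+k≤∣p∣+∣q∣ : (p q : Subset n) {k : ℕ} → k ≤ ∣ p ∩ q ∣ → ∣ p ∪ q ∣ + k ≤ ∣ p ∣ + ∣ q ∣
  ∣p∪q∣+k≤∣p∣+∣q∣ p q k≤ = ≤-trans (+-monoʳ-≤ ∣ p ∪ q ∣ k≤) (≤-reflexive (∣p∪q∣+∣p∩q∣≡∣p∣+∣q∣ p q))

  ∣p∪q∣≤∣p∣+∣q∣ : (p q : Subset n) → ∣ p ∪ q ∣ ≤ ∣ p ∣ + ∣ q ∣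
  ∣p∪q∣≤∣p∣+∣q∣ p q = ≤-trans (m≤m+n _ _) (∣p∪q∣+k≤∣p∣+∣q∣ p q z≤n)

  p∩q≡⁅x⁆⇒x∈p : {p q : Subset n} {x : Fin n} → p ∩ q ≡ ⁅ x ⁆ → x ∈ p
  p∩q≡⁅x⁆⇒x∈p {p} {q} {x} p∩q≡⁅x⁆ = proj₁ (x∈p∩q⁻ p q (subst (x ∈_) (sym p∩q≡⁅x⁆) (x∈⁅x⁆ x)))

  p≡⁅x⁆⇒∣p∣%2≡1 : {p : Subset n} {x : Fin n} → p ≡ ⁅ x ⁆ → ∣ p ∣ % 2 ≡ 1
  p≡⁅x⁆⇒∣p∣%2≡1 {x = x} refl = cong (_% 2) (∣⁅x⁆∣≡1 x)

  x∈p⇒1≤∣p∣ : {x : Fin n} {p : Subset n} → x ∈ p → 1 ≤ ∣ p ∣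
  x∈p⇒1≤∣p∣ x∈p = ≤-trans (s≤s z≤n) (x∈p⇒∣p-x∣<∣p∣ x∈p)

  x∈p∧y∈p∧x≢y⇒2≤∣p∣ : {x y : Fin n} {p : Subset n} → x ∈ p → y ∈ p → x ≢ y → 2 ≤ ∣ p ∣
  x∈p∧y∈p∧x≢y⇒2≤∣p∣ x∈p y∈p x≢y =
    ≤-trans (s≤s (x∈p⇒1≤∣p∣ (x∈p∧x≢y⇒x∈p-y y∈p (x≢y ∘ sym)))) (x∈p⇒∣p-x∣<∣p∣ x∈p)

  0<∣p∣⇒Nonempty : (p : Subset n) → 0 < ∣ p ∣ → Nonempty p
  0<∣p∣⇒Nonempty p 0<∣p∣ with nonempty? p
  ... | yes p≠∅   = p≠∅
  ... | no  empty =
    contradiction (subst (0 <_) (trans (cong ∣_∣ (Empty-unique empty)) (∣⊥∣≡0 n)) 0<∣p∣) λ ()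

  p⊈q⇒∃∈p∉q : {p q : Subset n} → ¬ p ⊆ q → ∃[ x ] (x ∈ p × x ∉ q)
  p⊈q⇒∃∈p∉q {p} {q} p⊈q with any? (λ x → (x ∈? p) ×-dec ¬? (x ∈? q))
  ... | yes witness = witness
  ... | no  none    = ⊥-elim (p⊈q p⊆q)
    where
    p⊆q : p ⊆ q
    p⊆q {x} x∈p with x ∈? q
    ... | yes x∈q = x∈q
    ... | no  x∉q = contradiction (x , x∈p , x∉q) none

  ∪-⊆ : {p q r : Subset n} → p ⊆ r → q ⊆ r → p ∪ q ⊆ r
  ∪-⊆ {p} {q} p⊆r q⊆r x∈p∪q with x∈p∪q⁻ p q x∈p∪q
  ... | inj₁ x∈p = p⊆r x∈p
  ... | inj₂ x∈q = q⊆r x∈q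

  p⊆q⇒p∪q≡q : {p q : Subset n} → p ⊆ q → p ∪ q ≡ q
  p⊆q⇒p∪q≡q {p} {q} p⊆q = ⊆-antisym (∪-⊆ p⊆q id) (q⊆p∪q p q)

  p⊆q⇒∣p∩q∣≡∣p∣ : {p q : Subset n} → p ⊆ q → ∣ p ∩ q ∣ ≡ ∣ p ∣
  p⊆q⇒∣p∩q∣≡∣p∣ {p} {q} p⊆q = cong ∣_∣ (⊆-antisym (p∩q⊆p p q) (λ x∈p → x∈p∩q⁺ (x∈p , p⊆q x∈p)))

module _ {n : ℕ} (H : Hypergraph n) where

  [_] : Subset n → ℕ
  [ X ] = ⟦_⟧ H X

  private
    ⊆-count : Subset n → Subset n → ℕ
    ⊆-count X h = indicator (h ⊆? X)

    [X]≡sum : ∀ X → [ X ] ≡ sum (map (⊆-count X) (edges H))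
    [X]≡sum X = length-filter≡sum-indicator (_⊆? X) (edges H)

  []-supermodular : ∀ A B → [ A ] + [ B ] ≤ [ A ∪ B ] + [ A ∩ B ]
  []-supermodular A B = begin
    [ A ] + [ B ]
      ≡⟨ cong₂ _+_ ([X]≡sum A) ([X]≡sum B) ⟩
    sum (map (⊆-count A) es) + sum (map (⊆-count B) es)
      ≡⟨ sum-map-+ (⊆-count A) (⊆-count B) es ⟨
    sum (map (λ h → ⊆-count A h + ⊆-count B h) es)
      ≤⟨ sum-map-mono es (λ {h} _ → pointwise h) ⟩
    sum (map (λ h → ⊆-count (A ∪ B) h + ⊆-count (A ∩ B) h) es)
      ≡⟨ sum-map-+ (⊆-count (A ∪ B)) (⊆-count (A ∩ B)) es ⟩
    sum (map (⊆-count (A ∪ B)) es) + sum (map (⊆-count (A ∩ B)) es)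
      ≡⟨ cong₂ _+_ ([X]≡sum (A ∪ B)) ([X]≡sum (A ∩ B)) ⟨
    [ A ∪ B ] + [ A ∩ B ] ∎
    where
    open ≤-Reasoning
    es = edges H
    ⊆∪ : ∀ {h} → h ⊆ A ∪ B → ⊆-count (A ∪ B) h ≡ 1
    ⊆∪ {h} = indicator-yes (h ⊆? A ∪ B)
    pointwise : ∀ h → ⊆-count A h + ⊆-count B h ≤ ⊆-count (A ∪ B) h + ⊆-count (A ∩ B) h
    pointwise h with h ⊆? A | h ⊆? B
    ... | yes h⊆A | yes h⊆B = ≤-reflexive (sym (cong₂ _+_ (⊆∪ (⊆-trans h⊆A (p⊆p∪q B)))
            (indicator-yes (h ⊆? A ∩ B) (λ x∈h → x∈p∩q⁺ (h⊆A x∈h , h⊆B x∈h)))))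
    ... | yes h⊆A | no  _   = ≤-trans (≤-reflexive (sym (⊆∪ (⊆-trans h⊆A (p⊆p∪q B)))))
                                      (m≤m+n _ _)
    ... | no  _   | yes h⊆B = ≤-trans (≤-reflexive (sym (⊆∪ (⊆-trans h⊆B (q⊆p∪q A B)))))
                                      (m≤m+n _ _)
    ... | no  _   | no  _   = z≤n

  [B]+2≤[U] : ∀ {B U h₁ h₂} → h₁ ∈ₗ edges H → h₂ ∈ₗ edges H → h₁ ≢ h₂ →
              B ⊆ U → h₁ ⊆ U → h₂ ⊆ U → ¬ h₁ ⊆ B → ¬ h₂ ⊆ B → [ B ] + 2 ≤ [ U ]
  [B]+2≤[U] {B} {U} {h₁} {h₂} h₁∈ h₂∈ h₁≢h₂ B⊆U h₁⊆U h₂⊆U h₁⊈B h₂⊈B = begin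
    [ B ] + 2
      ≤⟨ +-monoʳ-≤ [ B ] (+-mono-≤ (occurs h₁∈) (occurs h₂∈)) ⟩
    [ B ] + (sum (map (≡-count h₁) es) + sum (map (≡-count h₂) es))
      ≡⟨ cong₂ _+_ ([X]≡sum B) (sym (sum-map-+ (≡-count h₁) (≡-count h₂) es)) ⟩
    sum (map (⊆-count B) es) + sum (map (λ h → ≡-count h₁ h + ≡-count h₂ h) es)
      ≡⟨ sum-map-+ (⊆-count B) _ es ⟨
    sum (map (λ h → ⊆-count B h + (≡-count h₁ h + ≡-count h₂ h)) es)
      ≤⟨ sum-map-mono es (λ {h} _ → pointwise h) ⟩
    sum (map (⊆-count U) es)
      ≡⟨ [X]≡sum U ⟨
    [ U ] ∎
    where
    open ≤-Reasoning
    es = edges H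
    ≡-count : Subset n → Subset n → ℕ
    ≡-count a h = indicator (≡-dec _≟ᵇ_ h a)
    occurs : ∀ {a} → a ∈ₗ es → 1 ≤ sum (map (≡-count a) es)
    occurs {a} a∈ = ≤-trans (≤-reflexive (sym (indicator-yes (≡-dec _≟ᵇ_ a a) refl)))
                            (∈⇒≤sum-map (≡-count a) a∈)
    ⊆U : ∀ {h} → h ⊆ U → ⊆-count U h ≡ 1
    ⊆U {h} = indicator-yes (h ⊆? U)
    pointwise : ∀ h → ⊆-count B h + (≡-count h₁ h + ≡-count h₂ h) ≤ ⊆-count U h
    pointwise h with h ⊆? B | ≡-dec _≟ᵇ_ h h₁ | ≡-dec _≟ᵇ_ h h₂
    ... | yes h⊆B | yes refl | _        = ⊥-elim (h₁⊈B h⊆B)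
    ... | yes h⊆B | no  _    | yes refl = ⊥-elim (h₂⊈B h⊆B)
    ... | yes h⊆B | no  _    | no  _    = ≤-reflexive (sym (⊆U (⊆-trans h⊆B B⊆U)))
    ... | no  _   | yes refl | yes refl = contradiction refl h₁≢h₂
    ... | no  _   | yes refl | no  _    = ≤-reflexive (sym (⊆U h₁⊆U))
    ... | no  _   | no  _    | yes refl = ≤-reflexive (sym (⊆U h₂⊆U))
    ... | no  _   | no  _    | no  _    = z≤n

  edge-Nonempty : ∀ {h} → h ∈ₗ edges H → Nonempty h
  edge-Nonempty {h} h∈ = 0<∣p∣⇒Nonempty h (subst (0 <_) (sym (All.lookup (size3 H) h∈)) (s≤s z≤n))

  0<[X]⇒Nonempty : ∀ X → 0 < [ X ] → Nonempty X
  0<[X]⇒Nonempty X 0<[X] with filter (_⊆? X) (edges H) in eq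
  ... | h ∷ _ with ∈-filter⁻ (_⊆? X) (subst (h ∈ₗ_) (sym eq) (here refl))
  ...   | h∈ , h⊆X with edge-Nonempty h∈
  ...     | x , x∈h = x , h⊆X x∈h

  ¬Dense⇒2[X]≤∣X∣ : ∀ {X} → ¬ Dense H X → 2 * [ X ] ≤ ∣ X ∣
  ¬Dense⇒2[X]≤∣X∣ {X} ¬dense with 2 * [ X ] ≤? ∣ X ∣
  ... | yes 2[X]≤∣X∣ = 2[X]≤∣X∣
  ... | no  2[X]≰∣X∣ = contradiction (0<[X]⇒Nonempty X 0<[X] , <⇒≤ (≰⇒> 2[X]≰∣X∣)) ¬dense
    where
    0<[X] : 0 < [ X ]
    0<[X] = n≢0⇒n>0 λ [X]≡0 → 2[X]≰∣X∣ (subst (λ k → 2 * k ≤ ∣ X ∣) (sym [X]≡0) z≤n)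

  ∣X∪h∣+k≤∣X∣+3 : ∀ X {h k} → h ∈ₗ edges H → k ≤ ∣ X ∩ h ∣ → ∣ X ∪ h ∣ + k ≤ ∣ X ∣ + 3
  ∣X∪h∣+k≤∣X∣+3 X {h} h∈ k≤ =
    subst (λ m → ∣ X ∪ h ∣ + _ ≤ ∣ X ∣ + m) (All.lookup (size3 H) h∈) (∣p∪q∣+k≤∣p∣+∣q∣ X h k≤)

  Dense-∪ : ∀ {A B} → Dense H A → Dense H B → 2 * [ A ∩ B ] ≤ ∣ A ∩ B ∣ → Dense H (A ∪ B)
  Dense-∪ {A} {B} ((x , x∈A) , ∣A∣≤2[A]) (_ , ∣B∣≤2[B]) 2[A∩B]≤∣A∩B∣ =
    (x , p⊆p∪q B x∈A) , +-cancelʳ-≤ ∣ A ∩ B ∣ _ _ (begin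
      ∣ A ∪ B ∣ + ∣ A ∩ B ∣          ≡⟨ ∣p∪q∣+∣p∩q∣≡∣p∣+∣q∣ A B ⟩
      ∣ A ∣ + ∣ B ∣                  ≤⟨ +-mono-≤ ∣A∣≤2[A] ∣B∣≤2[B] ⟩
      2 * [ A ] + 2 * [ B ]          ≡⟨ *-distribˡ-+ 2 [ A ] [ B ] ⟨
      2 * ([ A ] + [ B ])            ≤⟨ *-monoʳ-≤ 2 ([]-supermodular A B) ⟩
      2 * ([ A ∪ B ] + [ A ∩ B ])    ≡⟨ *-distribˡ-+ 2 [ A ∪ B ] [ A ∩ B ] ⟩
      2 * [ A ∪ B ] + 2 * [ A ∩ B ]  ≤⟨ +-monoʳ-≤ (2 * [ A ∪ B ]) 2[A∩B]≤∣A∩B∣ ⟩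
      2 * [ A ∪ B ] + ∣ A ∩ B ∣      ∎)
    where open ≤-Reasoning

  MinimalDense-∪ : ∀ {A B} → MinimalDense H A → Dense H B → Dense H (A ∪ B)
  MinimalDense-∪ {A} {B} (dense-A , minimal) dense-B with A ⊆? B
  ... | yes A⊆B = subst (Dense H) (sym (p⊆q⇒p∪q≡q A⊆B)) dense-B
  ... | no  A⊈B with p⊈q⇒∃∈p∉q A⊈B
  ...   | x , x∈A , x∉B = Dense-∪ dense-A dense-B (¬Dense⇒2[X]≤∣X∣ (minimal (A ∩ B) A∩B⊂A))
    where
    A∩B⊂A : A ∩ B ⊂ A
    A∩B⊂A = p∩q⊆p A B , x , x∈A , x∉B ∘ proj₂ ∘ x∈p∩q⁻ A B

  Dense? : ∀ X → Dec (Dense H X)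
  Dense? X = nonempty? X ×-dec (∣ X ∣ ≤? 2 * [ X ])

  Dense⇒∃MinimalDense⊆ : ∀ {X} → Dense H X → ∃[ Y ] (Y ⊆ X × MinimalDense H Y)
  Dense⇒∃MinimalDense⊆ {X} = go (suc ∣ X ∣) X ≤-refl
    where
    go : ∀ k Y → ∣ Y ∣ < k → Dense H Y → ∃[ Z ] (Z ⊆ Y × MinimalDense H Z)
    go (suc k) Y ∣Y∣<1+k dense-Y with anySubset? (λ Z → (Z ⊂? Y) ×-dec Dense? Z)
    ... | no  none = Y , id , dense-Y , λ Z Z⊂Y dense-Z → none (Z , Z⊂Y , dense-Z)
    ... | yes (Z , Z⊂Y , dense-Z)
        with go k Z (≤-trans (p⊂q⇒∣p∣<∣q∣ Z⊂Y) (≤-pred ∣Y∣<1+k)) dense-Z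
    ...   | W , W⊆Z , minimal-W = W , ⊆-trans W⊆Z (p⊂q⇒p⊆q Z⊂Y) , minimal-W

  ∪-two-edges-SuperDense : ∀ {B h₁ h₂ a c y} → ∣ B ∣ ≤ 2 * [ B ] →
    h₁ ∈ₗ edges H → h₂ ∈ₗ edges H → h₁ ≢ h₂ → a ∈ B → a ∈ h₁ → c ∈ B → c ∈ h₂ →
    y ∉ B → y ∈ h₁ → y ∈ h₂ →
    ∣ (B ∪ h₁) ∪ h₂ ∣ ≤ ∣ B ∣ + 3 × SuperDense H ((B ∪ h₁) ∪ h₂)
  ∪-two-edges-SuperDense {B} {h₁} {h₂} {a} {c} {y}
    ∣B∣≤2[B] h₁∈ h₂∈ h₁≢h₂ a∈B a∈h₁ c∈B c∈h₂ y∉B y∈h₁ y∈h₂ =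
    ∣U∣≤∣B∣+3 , (y , q⊆p∪q (B ∪ h₁) h₂ y∈h₂) , (begin-strict
      ∣ U ∣              ≤⟨ ∣U∣≤∣B∣+3 ⟩
      ∣ B ∣ + 3          ≤⟨ +-monoˡ-≤ 3 ∣B∣≤2[B] ⟩
      2 * [ B ] + 3      <⟨ +-monoʳ-< (2 * [ B ]) (n<1+n 3) ⟩
      2 * [ B ] + 4      ≡⟨ *-distribˡ-+ 2 [ B ] 2 ⟨
      2 * ([ B ] + 2)    ≤⟨ *-monoʳ-≤ 2 [U]≥[B]+2 ⟩
      2 * [ U ]          ∎)
    where
    open ≤-Reasoning
    U = (B ∪ h₁) ∪ h₂
    ∣B∪h₁∣+1≤∣B∣+3 : ∣ B ∪ h₁ ∣ + 1 ≤ ∣ B ∣ + 3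
    ∣B∪h₁∣+1≤∣B∣+3 = ∣X∪h∣+k≤∣X∣+3 B h₁∈ (x∈p⇒1≤∣p∣ (x∈p∩q⁺ (a∈B , a∈h₁)))
    y≢c : y ≢ c
    y≢c refl = y∉B c∈B
    ∣U∣+2≤∣B∪h₁∣+3 : ∣ U ∣ + 2 ≤ ∣ B ∪ h₁ ∣ + 3
    ∣U∣+2≤∣B∪h₁∣+3 = ∣X∪h∣+k≤∣X∣+3 (B ∪ h₁) h₂∈ (x∈p∧y∈p∧x≢y⇒2≤∣p∣
      (x∈p∩q⁺ (q⊆p∪q B h₁ y∈h₁ , y∈h₂)) (x∈p∩q⁺ (p⊆p∪q h₁ c∈B , c∈h₂)) y≢c)
    ∣U∣≤∣B∣+3 : ∣ U ∣ ≤ ∣ B ∣ + 3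
    ∣U∣≤∣B∣+3 = +-cancelʳ-≤ 2 ∣ U ∣ (∣ B ∣ + 3) (begin
      ∣ U ∣ + 2            ≤⟨ ∣U∣+2≤∣B∪h₁∣+3 ⟩
      ∣ B ∪ h₁ ∣ + 3       ≡⟨ +-assoc ∣ B ∪ h₁ ∣ 1 2 ⟨
      ∣ B ∪ h₁ ∣ + 1 + 2   ≤⟨ +-monoˡ-≤ 2 ∣B∪h₁∣+1≤∣B∣+3 ⟩
      ∣ B ∣ + 3 + 2        ∎)
    [U]≥[B]+2 : [ B ] + 2 ≤ [ U ]
    [U]≥[B]+2 = [B]+2≤[U] h₁∈ h₂∈ h₁≢h₂ (⊆-trans (p⊆p∪q h₁) (p⊆p∪q h₂))
      (⊆-trans (q⊆p∪q B h₁) (p⊆p∪q h₂)) (q⊆p∪q (B ∪ h₁) h₂)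
      (λ h₁⊆B → y∉B (h₁⊆B y∈h₁)) (λ h₂⊆B → y∉B (h₂⊆B y∈h₂))

4l+3≤2[2l+2] : ∀ l → 2 * l + 2 * l + 3 ≤ 2 * (2 * l + 2)
4l+3≤2[2l+2] l = ≤-trans (+-monoʳ-≤ (2 * l + 2 * l) (n≤1+n 3))
  (≤-reflexive (solve 1 (λ l → (con 2 :* l :+ con 2 :* l) :+ con 4 := con 2 :* (con 2 :* l :+ con 2)) refl l))
  where open +-*-Solver using (solve; _:+_; _:*_; _:=_; con)

module _ {n : ℕ} (H : Hypergraph n) (l : ℕ) (R : Subset n) (R-red : IsRedSet H l R) where

  RedBlock⇒⊆R : ∀ {B} → RedBlock H l B → B ⊆ R
  RedBlock⇒⊆R {B} block v∈B = proj₂ (R-red _) (B , block , v∈B)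

  red-pair⊆dense-red-set : ∀ {a c} → a ∈ R → c ∈ R →
    ∃[ B ] (Dense H B × B ⊆ R × ∣ B ∣ ≤ 2 * l + 2 * l × a ∈ B × c ∈ B)
  red-pair⊆dense-red-set {a} {c} a∈R c∈R with proj₁ (R-red a) a∈R | proj₁ (R-red c) c∈R
  ... | B₁ , block₁ , a∈B₁ | B₂ , block₂ , c∈B₂ =
    B₁ ∪ B₂ ,
    MinimalDense-∪ H (proj₁ block₁) (proj₁ (proj₁ block₂)) ,
    ∪-⊆ (RedBlock⇒⊆R block₁) (RedBlock⇒⊆R block₂) ,
    ≤-trans (∣p∪q∣≤∣p∣+∣q∣ B₁ B₂) (+-mono-≤ (proj₂ block₁) (proj₂ block₂)) ,
    p⊆p∪q B₂ a∈B₁ ,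
    q⊆p∪q B₁ B₂ c∈B₂

  green-edge-through-green-vertex : Modest H (2 * l + 2) → ∀ {y h₁ h₂} → y ∉ R →
    h₁ ∈ₗ edges H → h₂ ∈ₗ edges H → h₁ ≢ h₂ → y ∈ h₁ → y ∈ h₂ → h₁ ⊆ ∁ R ⊎ h₂ ⊆ ∁ R
  green-edge-through-green-vertex modest {y} {h₁} {h₂} y∉R h₁∈ h₂∈ h₁≢h₂ y∈h₁ y∈h₂
    with h₁ ⊆? ∁ R | h₂ ⊆? ∁ R
  ... | yes h₁⊆∁R | _         = inj₁ h₁⊆∁R
  ... | no  _     | yes h₂⊆∁R = inj₂ h₂⊆∁R
  ... | no  h₁⊈∁R | no  h₂⊈∁R
    with p⊈q⇒∃∈p∉q h₁⊈∁R | p⊈q⇒∃∈p∉q h₂⊈∁R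
  ... | a , a∈h₁ , a∉∁R | c , c∈h₂ , c∉∁R
    with red-pair⊆dense-red-set (x∉∁p⇒x∈p a∉∁R) (x∉∁p⇒x∈p c∉∁R)
  ... | B , (_ , ∣B∣≤2[B]) , B⊆R , ∣B∣≤4l , a∈B , c∈B
    with ∪-two-edges-SuperDense H ∣B∣≤2[B] h₁∈ h₂∈ h₁≢h₂ a∈B a∈h₁ c∈B c∈h₂ (y∉R ∘ B⊆R) y∈h₁ y∈h₂
  ... | ∣U∣≤∣B∣+3 , superDense =
    ⊥-elim (modest _ (≤-trans ∣U∣≤∣B∣+3 (≤-trans (+-monoˡ-≤ 3 ∣B∣≤4l) (4l+3≤2[2l+2] l))) superDense)

  ∁R-odd : ∀ {n′} → Modest H (2 * l + 2) → BigSetsHaveEdges H n′ → SmallSetsCondition H n′ →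
           OddOn H (∁ R)
  ∁R-odd {n′} modest big small X X⊆∁R X≠∅ with n′ ≤? ∣ X ∣
  ... | yes n′≤∣X∣ with big X n′≤∣X∣
  ...   | h , h∈ , h⊆X =
    h , h∈ , ⊆-trans h⊆X X⊆∁R , cong (_% 2) (trans (p⊆q⇒∣p∩q∣≡∣p∣ h⊆X) (All.lookup (size3 H) h∈))
  ∁R-odd {n′} modest big small X X⊆∁R X≠∅ | no n′≰∣X∣
    with small X X≠∅ (≰⇒> n′≰∣X∣)
  ... | y , y∈X , h₁ , h₂ , h₁∈ , h₂∈ , h₁≢h₂ , h₁∩X≡⁅y⁆ , h₂∩X≡⁅y⁆
    with green-edge-through-green-vertex modest (x∈∁p⇒x∉p (X⊆∁R y∈X)) h₁∈ h₂∈ h₁≢h₂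
           (p∩q≡⁅x⁆⇒x∈p h₁∩X≡⁅y⁆) (p∩q≡⁅x⁆⇒x∈p h₂∩X≡⁅y⁆)
  ... | inj₁ h₁⊆∁R = h₁ , h₁∈ , h₁⊆∁R , p≡⁅x⁆⇒∣p∣%2≡1 h₁∩X≡⁅y⁆
  ... | inj₂ h₂⊆∁R = h₂ , h₂∈ , h₂⊆∁R , p≡⁅x⁆⇒∣p∣%2≡1 h₂∩X≡⁅y⁆

  ∁R-meager : MeagerOn H (∁ R) l
  ∁R-meager X X⊆∁R ∣X∣≤2l dense-X with Dense⇒∃MinimalDense⊆ H dense-X
  ... | Y , Y⊆X , minimal-Y with proj₁ (proj₁ minimal-Y)
  ...   | v , v∈Y = x∈∁p⇒x∉p (X⊆∁R (Y⊆X v∈Y))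
                      (RedBlock⇒⊆R (minimal-Y , ≤-trans (p⊆q⇒∣p∣≤∣q∣ Y⊆X) ∣X∣≤2l) v∈Y)

theorem2p3p1 : (l n n′ : ℕ) → 2 ≤ l → (H : Hypergraph n) → n′ < n →
    Modest H (2 * l + 2) →
    (R : Subset n) → IsRedSet H l R → ∣ R ∣ < n′ →
    BigSetsHaveEdges H n′ →
    SmallSetsCondition H n′ →
    OddOn H (∁ R) × MeagerOn H (∁ R) l × n ∸ n′ < ∣ ∁ R ∣
theorem2p3p1 l n n′ _ H n′<n modest R R-red ∣R∣<n′ big small =
  ∁R-odd H l R R-red modest big small ,
  ∁R-meager H l R R-red ,
  subst (n ∸ n′ <_) (sym (∣∁p∣≡n∸∣p∣ R)) (∸-monoʳ-< ∣R∣<n′ (<⇒≤ n′<n))
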